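{- Let $C$ be a cycle whose vertex set is partitioned into three nonempty sets $V_1,V_2,V_3$, each of which is the vertex set of a subpath of $C$. Let $S$ be a set of vertices disjoint from $V(C)$, and let $\widehat C$ be a graph with vertex set $V(C)\cup S$ whose edges are the edges of $C$ together with edges between $S$ and $V(C)$, such that every vertex of $S$ has exactly one neighbour in each of $V_1,V_2,V_3$ and every vertex of $C$ has at most one neighbour in $S$. Then $\widehat C$ is $2$-connected. Moreover, every cutset $U$ of $\widehat C$ with $|U|=2$ satisfies $U\subseteq V(C)$, and $\widehat C\setminus U$ has exactly two connected components, one of which is a path in $C$ consisting of vertices of degree $2$ in $\widehat C$.
   Context: A cutset of a graph $G$ is a set $U\subseteq V(G)$ such that $G\setminus U$ is disconnected. A graph $G$ is $k$-connected if $|V(G)|\ge k+1$ and it has no cutset of size at most $k-1$. -}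

module Defs where

open import Data.Nat using (ℕ; zero; suc; _+_; _≤_; _<_; _≡ᵇ_)
open import Data.Bool using (Bool; true; false; _∨_; _∧_; T)
open import Data.Fin using (Fin; toℕ; splitAt; _↑ˡ_)
open import Data.Fin.Subset using (Subset; _∉_; ∣_∣)
open import Data.Vec using (tabulate)
open import Data.Sum using (_⊎_; inj₁; inj₂)
open import Data.Product using (Σ; ∃; _×_; _,_)
open import Relation.Binary.PropositionalEquality using (_≡_)
open import Relation.Nullary using (¬_)
open import Function.Bundles using (_⇔_)

Adjacency : ℕ → Set
Adjacency N = Fin N → Fin N → Bool

nbhd : ∀ {N} → Adjacency N → Fin N → Subset N
nbhd A v = tabulate (A v)

degree : ∀ {N} → Adjacency N → Fin N → ℕ
degree A v = ∣ nbhd A v ∣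

data Reach {N : ℕ} (A : Adjacency N) (U : Subset N) : Fin N → Fin N → Set where
  here : ∀ {x} → x ∉ U → Reach A U x x
  step : ∀ {x y z} → x ∉ U → T (A x y) → Reach A U y z → Reach A U x z

Disconnected : ∀ {N} → Adjacency N → Subset N → Set
Disconnected A U = ∃ λ x → ∃ λ y → x ∉ U × y ∉ U × ¬ Reach A U x y

Cutset : ∀ {N} → Adjacency N → Subset N → Set
Cutset A U = Disconnected A U

KConnected : ∀ {N} → ℕ → Adjacency N → Set
KConnected {N} k A = k + 1 ≤ N × (∀ (U : Subset N) → ∣ U ∣ < k → ¬ Cutset A U)

cycAdj : (m : ℕ) → Fin m → Fin m → Bool
cycAdj m i j =
  (toℕ j ≡ᵇ suc (toℕ i)) ∨ (toℕ i ≡ᵇ suc (toℕ j))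
  ∨ ((toℕ i ≡ᵇ 0) ∧ (suc (toℕ j) ≡ᵇ m))
  ∨ ((toℕ j ≡ᵇ 0) ∧ (suc (toℕ i) ≡ᵇ m))

-- x lies on the arc of C starting at i with l vertices
-- (i, i+1, ..., i+l-1, indices mod m).
InArc : (m : ℕ) → Fin m → ℕ → Fin m → Set
InArc m i l x = (toℕ i ≤ toℕ x × toℕ x < toℕ i + l) ⊎ (toℕ x + m < toℕ i + l)

IsSubpathVertexSet : (m : ℕ) → (Fin m → Set) → Set
IsSubpathVertexSet m P =
  ∃ λ (i : Fin m) → ∃ λ (l : ℕ) → 1 ≤ l × l ≤ m × (∀ x → P x ⇔ InArc m i l x)

-- The graph Ĉ on V(C) ∪ S, with V(C) = Fin m embedded as the first m
-- vertices of Fin (m + s) and S = Fin s as the last s vertices.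
-- H v x says: vertex v ∈ S is adjacent to vertex x ∈ V(C).

hatAdj⊎ : (m s : ℕ) → (Fin s → Fin m → Bool) → Fin m ⊎ Fin s → Fin m ⊎ Fin s → Bool
hatAdj⊎ m s H (inj₁ i) (inj₁ j) = cycAdj m i j
hatAdj⊎ m s H (inj₁ i) (inj₂ v) = H v i
hatAdj⊎ m s H (inj₂ v) (inj₁ i) = H v i
hatAdj⊎ m s H (inj₂ v) (inj₂ w) = false

hatC : (m s : ℕ) → (Fin s → Fin m → Bool) → Adjacency (m + s)
hatC m s H x y = hatAdj⊎ m s H (splitAt m x) (splitAt m y)

IsCycleVertex : (m s : ℕ) → Fin (m + s) → Set
IsCycleVertex m s x = ∃ λ (i : Fin m) → x ≡ i ↑ˡ s

{-# OPTIONS --safe #-}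
-- Every vertex of S has neighbours in three different parts, so it has a neighbour outside any
-- set U of at most two vertices, and every component of Ĉ ∖ U meets C. A cutset U of at most two
-- vertices therefore consists of exactly two vertices lo < hi of C (so Ĉ is 2-connected), which cut
-- C into an inner arc (lo, hi) and an outer arc.
-- If both arcs had neighbours in S, pick a part V_k containing neither lo nor hi: the V_k-neighbours
-- of those two vertices of S either join the arcs, or lie one on each arc, and then the subpath V_k
-- passes through lo or hi. So one arc has no neighbour in S: it is a component of Ĉ ∖ U, and its
-- vertices have degree 2.
module Submission where

open import Defs
open import Data.Nat
  using (ℕ; zero; suc; pred; _+_; _∸_; _≤_; _<_; _≡ᵇ_; z≤n; s≤s; _≤?_; _<?_; >-nonZero)
open import Data.Nat.Properties
open import Data.Bool using (Bool; true; false; T; _∨_; _∧_)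
open import Data.Bool.Properties using (T-∧; T-≡)
open import Data.Unit using (tt)
open import Data.Empty using (⊥; ⊥-elim)
open import Data.Fin using (Fin; zero; suc; toℕ; fromℕ<; fromℕ; _↑ˡ_; _↑ʳ_; splitAt)
open import Data.Fin.Properties
  using ( toℕ-injective; toℕ-fromℕ<; toℕ-fromℕ; toℕ<n; any?
        ; splitAt-↑ˡ; splitAt-↑ʳ; join-splitAt; ↑ˡ-injective)
import Data.Fin.Properties as Finₚ
open import Data.Fin.Subset using (Subset; inside; outside; _∈_; _∉_; ∣_∣; ⁅_⁆)
open import Data.Fin.Subset.Properties using (_∈?_; ⊆-antisym; ∣⁅x⁆∣≡1; x∈⁅x⁆; x∈⁅y⁆⇒x≡y; p⊆q⇒∣p∣≤∣q∣)
open import Data.Vec using (_∷_; tabulate; here; there)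
open import Data.Vec.Properties using (lookup∘tabulate; []=⇒lookup; lookup⇒[]=)
open import Data.Sum using (_⊎_; inj₁; inj₂; [_,_]′)
import Data.Sum
open import Data.Product using (∃; ∃₂; _×_; _,_)
open import Function using (_∘_; id)
open import Function.Bundles using (_⇔_; Equivalence; mk⇔)
open import Function.Construct.Composition using (_⇔-∘_)
open import Relation.Binary using (tri<; tri≈; tri>)
open import Relation.Binary.PropositionalEquality
  using (_≡_; _≢_; refl; sym; trans; cong; subst; module ≡-Reasoning)
open import Relation.Nullary using (¬_; Dec; yes; no; contradiction)
open import Relation.Nullary.Decidable using (T?; _×-dec_; _⊎-dec_)

open Equivalence using (to; from)

module _ {N : ℕ} {A : Adjacency N} {U : Subset N} where

  reach-source : ∀ {x y} → Reach A U x y → x ∉ U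
  reach-source (here x∉U)     = x∉U
  reach-source (step x∉U _ _) = x∉U

  reach-trans : ∀ {x y z} → Reach A U x y → Reach A U y z → Reach A U x z
  reach-trans (here _)         r = r
  reach-trans (step x∉U e r′) r = step x∉U e (reach-trans r′ r)

  reach-edge : ∀ {x y} → x ∉ U → y ∉ U → T (A x y) → Reach A U x y
  reach-edge x∉U y∉U e = step x∉U e (here y∉U)

  reach-closed : (P : Fin N → Set) → (∀ {x y} → x ∉ U → T (A x y) → P y → P x)
               → ∀ {x y} → Reach A U x y → P y → P x
  reach-closed P closed (here _)       Py = Py
  reach-closed P closed (step x∉U e r) Py = closed x∉U e (reach-closed P closed r Py)

  reach-sym : (∀ x y → T (A x y) → T (A y x)) → ∀ {x y} → Reach A U x y → Reach A U y x
  reach-sym A-sym (here y∉U)     = here y∉U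
  reach-sym A-sym (step x∉U e r) =
    reach-trans (reach-sym A-sym r) (reach-edge (reach-source r) x∉U (A-sym _ _ e))

x∈p⇒0<∣p∣ : ∀ {n} {x : Fin n} {p} → x ∈ p → 0 < ∣ p ∣
x∈p⇒0<∣p∣ {x = x} {p} x∈p = subst (_≤ ∣ p ∣) (∣⁅x⁆∣≡1 x) (p⊆q⇒∣p∣≤∣q∣ ⁅x⁆⊆p)
  where
  ⁅x⁆⊆p : ∀ {y} → y ∈ ⁅ x ⁆ → y ∈ p
  ⁅x⁆⊆p y∈⁅x⁆ = subst (_∈ p) (sym (x∈⁅y⁆⇒x≡y x y∈⁅x⁆)) x∈p

x∈p∧only⇒∣p∣≡1 : ∀ {n} {x : Fin n} {p} → x ∈ p → (∀ {z} → z ∈ p → z ≡ x) → ∣ p ∣ ≡ 1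
x∈p∧only⇒∣p∣≡1 {x = x} {p} x∈p only = trans (cong ∣_∣ p≡⁅x⁆) (∣⁅x⁆∣≡1 x)
  where
  p≡⁅x⁆ : p ≡ ⁅ x ⁆
  p≡⁅x⁆ = ⊆-antisym (λ z∈p → subst (_∈ ⁅ x ⁆) (sym (only z∈p)) (x∈⁅x⁆ x))
                    (λ z∈⁅x⁆ → subst (_∈ p) (sym (x∈⁅y⁆⇒x≡y x z∈⁅x⁆)) x∈p)

∣p∣≤1⇒x∈p⇒y∈p⇒x≡y : ∀ {n} {p : Subset n} {x y} → ∣ p ∣ ≤ 1 → x ∈ p → y ∈ p → x ≡ y
∣p∣≤1⇒x∈p⇒y∈p⇒x≡y {p = inside ∷ p} _           here        here        = refl
∣p∣≤1⇒x∈p⇒y∈p⇒x≡y {p = inside ∷ p} (s≤s ∣p∣≤0) here        (there y∈p) = ⊥-elim (<⇒≱ (x∈p⇒0<∣p∣ y∈p) ∣p∣≤0)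
∣p∣≤1⇒x∈p⇒y∈p⇒x≡y {p = inside ∷ p} (s≤s ∣p∣≤0) (there x∈p) _           = ⊥-elim (<⇒≱ (x∈p⇒0<∣p∣ x∈p) ∣p∣≤0)
∣p∣≤1⇒x∈p⇒y∈p⇒x≡y {p = outside ∷ p} ∣p∣≤1 (there x∈p) (there y∈p) =
  cong suc (∣p∣≤1⇒x∈p⇒y∈p⇒x≡y ∣p∣≤1 x∈p y∈p)

∣p∣≤2⇒pigeonhole : ∀ {n} {p : Subset n} {x y z} → ∣ p ∣ ≤ 2 → x ∈ p → y ∈ p → z ∈ p
                 → x ≡ y ⊎ x ≡ z ⊎ y ≡ z
∣p∣≤2⇒pigeonhole {p = inside ∷ p} _ here here _ = inj₁ refl
∣p∣≤2⇒pigeonhole {p = inside ∷ p} _ here (there _) here = inj₂ (inj₁ refl)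
∣p∣≤2⇒pigeonhole {p = inside ∷ p} _ (there _) here here = inj₂ (inj₂ refl)
∣p∣≤2⇒pigeonhole {p = inside ∷ p} (s≤s ∣p∣≤1) here (there y∈p) (there z∈p) =
  inj₂ (inj₂ (cong suc (∣p∣≤1⇒x∈p⇒y∈p⇒x≡y ∣p∣≤1 y∈p z∈p)))
∣p∣≤2⇒pigeonhole {p = inside ∷ p} (s≤s ∣p∣≤1) (there x∈p) here (there z∈p) =
  inj₂ (inj₁ (cong suc (∣p∣≤1⇒x∈p⇒y∈p⇒x≡y ∣p∣≤1 x∈p z∈p)))
∣p∣≤2⇒pigeonhole {p = inside ∷ p} (s≤s ∣p∣≤1) (there x∈p) (there y∈p) _ =
  inj₁ (cong suc (∣p∣≤1⇒x∈p⇒y∈p⇒x≡y ∣p∣≤1 x∈p y∈p))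
∣p∣≤2⇒pigeonhole {p = outside ∷ p} ∣p∣≤2 (there x∈p) (there y∈p) (there z∈p) =
  Data.Sum.map (cong suc) (Data.Sum.map (cong suc) (cong suc)) (∣p∣≤2⇒pigeonhole ∣p∣≤2 x∈p y∈p z∈p)

exactly-two⇒∣p∣≡2 : ∀ {n} {p : Subset n} {x y} → x ≢ y → x ∈ p → y ∈ p
                  → (∀ {z} → z ∈ p → z ≡ x ⊎ z ≡ y) → ∣ p ∣ ≡ 2
exactly-two⇒∣p∣≡2 {p = inside ∷ p} x≢y here here _ = contradiction refl x≢y
exactly-two⇒∣p∣≡2 {p = inside ∷ p} _ here (there y∈p) only =
  cong suc (x∈p∧only⇒∣p∣≡1 y∈p λ z∈p → [ (λ ()) , Finₚ.suc-injective ]′ (only (there z∈p)))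
exactly-two⇒∣p∣≡2 {p = inside ∷ p} _ (there x∈p) here only =
  cong suc (x∈p∧only⇒∣p∣≡1 x∈p λ z∈p → [ Finₚ.suc-injective , (λ ()) ]′ (only (there z∈p)))
exactly-two⇒∣p∣≡2 {p = inside ∷ p} _ (there _) (there _) only = [ (λ ()) , (λ ()) ]′ (only here)
exactly-two⇒∣p∣≡2 {p = outside ∷ p} x≢y (there x∈p) (there y∈p) only =
  exactly-two⇒∣p∣≡2 (λ x≡y → x≢y (cong suc x≡y)) x∈p y∈p
    (λ z∈p → Data.Sum.map Finₚ.suc-injective Finₚ.suc-injective (only (there z∈p)))

module _ {n : ℕ} {f : Fin n → Bool} where

  ∈-tabulate⁺ : ∀ {x} → T (f x) → x ∈ tabulate f
  ∈-tabulate⁺ {x} fx = lookup⇒[]= x (tabulate f) (trans (lookup∘tabulate f x) (to T-≡ fx))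

  ∈-tabulate⁻ : ∀ {x} → x ∈ tabulate f → T (f x)
  ∈-tabulate⁻ {x} x∈ = from T-≡ (trans (sym (lookup∘tabulate f x)) ([]=⇒lookup x∈))

-- Steps and arcs of the cycle

data CycleStep (m a b : ℕ) : Set where
  next      : b ≡ suc a → CycleStep m a b
  prev      : a ≡ suc b → CycleStep m a b
  wrap-prev : a ≡ 0 → suc b ≡ m → CycleStep m a b
  wrap-next : b ≡ 0 → suc a ≡ m → CycleStep m a b

cycleStep-sym : ∀ {m a b} → CycleStep m a b → CycleStep m b a
cycleStep-sym (next e)        = prev e
cycleStep-sym (prev e)        = next e
cycleStep-sym (wrap-prev e f) = wrap-next e f
cycleStep-sym (wrap-next e f) = wrap-prev e f

T-∨₄ : ∀ a b c d → T (a ∨ b ∨ c ∨ d) ⇔ (T a ⊎ T b ⊎ T c ⊎ T d)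
T-∨₄ true  _     _     _     = mk⇔ inj₁ (λ _ → tt)
T-∨₄ false true  _     _     = mk⇔ (inj₂ ∘ inj₁) (λ _ → tt)
T-∨₄ false false true  _     = mk⇔ (inj₂ ∘ inj₂ ∘ inj₁) (λ _ → tt)
T-∨₄ false false false d     = mk⇔ (inj₂ ∘ inj₂ ∘ inj₂) [ (λ ()) , [ (λ ()) , [ (λ ()) , id ]′ ]′ ]′

module _ {m : ℕ} (i j : Fin m) where
  private
    a = toℕ i
    b = toℕ j

    Disjuncts : Set
    Disjuncts = T (b ≡ᵇ suc a) ⊎ T (a ≡ᵇ suc b)
              ⊎ T ((a ≡ᵇ 0) ∧ (suc b ≡ᵇ m)) ⊎ T ((b ≡ᵇ 0) ∧ (suc a ≡ᵇ m))

    cycAdj-disjuncts : T (cycAdj m i j) ⇔ Disjuncts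
    cycAdj-disjuncts = T-∨₄ _ _ _ _

  cycAdj⇔cycleStep : T (cycAdj m i j) ⇔ CycleStep m a b
  cycAdj⇔cycleStep =
    mk⇔ (λ adj → toStep (to cycAdj-disjuncts adj)) (λ st → from cycAdj-disjuncts (fromStep st))
    where
    toStep : Disjuncts → CycleStep m a b
    toStep (inj₁ e)                = next (≡ᵇ⇒≡ _ _ e)
    toStep (inj₂ (inj₁ e))         = prev (≡ᵇ⇒≡ _ _ e)
    toStep (inj₂ (inj₂ (inj₁ w))) = let e , f = to T-∧ w in wrap-prev (≡ᵇ⇒≡ _ _ e) (≡ᵇ⇒≡ _ _ f)
    toStep (inj₂ (inj₂ (inj₂ w))) = let e , f = to T-∧ w in wrap-next (≡ᵇ⇒≡ _ _ e) (≡ᵇ⇒≡ _ _ f)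

    fromStep : CycleStep m a b → Disjuncts
    fromStep (next e)        = inj₁ (≡⇒≡ᵇ _ _ e)
    fromStep (prev e)        = inj₂ (inj₁ (≡⇒≡ᵇ _ _ e))
    fromStep (wrap-prev e f) = inj₂ (inj₂ (inj₁ (from T-∧ (≡⇒≡ᵇ _ _ e , ≡⇒≡ᵇ _ _ f))))
    fromStep (wrap-next e f) = inj₂ (inj₂ (inj₂ (from T-∧ (≡⇒≡ᵇ _ _ e , ≡⇒≡ᵇ _ _ f))))

cycAdj-sym : ∀ {m} (i j : Fin m) → T (cycAdj m i j) → T (cycAdj m j i)
cycAdj-sym i j adj = from (cycAdj⇔cycleStep j i) (cycleStep-sym (to (cycAdj⇔cycleStep i j) adj))

cycleStep-inside : ∀ {m lo hi a b} → lo < a → a < hi → hi < m → CycleStep m a b → lo ≤ b × b ≤ hi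
cycleStep-inside {a = a} lo<a a<hi _    (next refl) = ≤-trans (<⇒≤ lo<a) (n≤1+n a) , a<hi
cycleStep-inside {b = b} lo<a a<hi _    (prev refl) = ≤-pred lo<a , ≤-trans (n≤1+n b) (<⇒≤ a<hi)
cycleStep-inside         ()   _    _    (wrap-prev refl _)
cycleStep-inside         _    a<hi hi<m (wrap-next _ refl) =
  ⊥-elim (<-irrefl refl (<-≤-trans a<hi (≤-pred hi<m)))

ExactlyTwo : ∀ {A : Set} → (A → Set) → Set
ExactlyTwo {A} P = ∃₂ λ u v → u ≢ v × P u × P v × (∀ w → P w → w ≡ u ⊎ w ≡ v)

cycle-two-neighbours : ∀ {m} → 3 ≤ m → (t : Fin m)
                     → ExactlyTwo (λ (u : Fin m) → CycleStep m (toℕ t) (toℕ u))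
cycle-two-neighbours (s≤s (s≤s (s≤s {n = n} _))) t with toℕ t | toℕ<n t
... | zero | _ =
  suc zero , fromℕ (2 + n) , (λ ()) , next refl , wrap-prev refl (cong suc (toℕ-fromℕ (2 + n))) , only
  where
  only : ∀ w → CycleStep (3 + n) 0 (toℕ w) → w ≡ suc zero ⊎ w ≡ fromℕ (2 + n)
  only w (next e)        = inj₁ (toℕ-injective e)
  only w (wrap-prev _ e) = inj₂ (toℕ-injective (trans (suc-injective e) (sym (toℕ-fromℕ (2 + n)))))
  only w (wrap-next _ ())
... | suc k | k+1<m with 2 + k <? 3 + n
...   | yes k+2<m =
  fromℕ< k+2<m , fromℕ< k<m , distinct
    , next (toℕ-fromℕ< k+2<m) , prev (cong suc (sym (toℕ-fromℕ< k<m))) , only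
  where
  k<m : k < 3 + n
  k<m = <-trans (n<1+n k) k+1<m
  distinct : fromℕ< k+2<m ≢ fromℕ< k<m
  distinct e with trans (sym (toℕ-fromℕ< k+2<m)) (trans (cong toℕ e) (toℕ-fromℕ< k<m))
  ... | ()
  only : ∀ w → CycleStep (3 + n) (suc k) (toℕ w) → w ≡ fromℕ< k+2<m ⊎ w ≡ fromℕ< k<m
  only w (next e)        = inj₁ (toℕ-injective (trans e (sym (toℕ-fromℕ< k+2<m))))
  only w (prev e)        = inj₂ (toℕ-injective (trans (sym (suc-injective e)) (sym (toℕ-fromℕ< k<m))))
  only w (wrap-next _ e) = contradiction e (<⇒≢ k+2<m)
...   | no k+2≮m =
  zero , fromℕ< k<m , distinct , wrap-next refl k+2≡m , prev (cong suc (sym (toℕ-fromℕ< k<m))) , only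
  where
  k+2≡m : 2 + k ≡ 3 + n
  k+2≡m = ≤-antisym k+1<m (≮⇒≥ k+2≮m)
  k<m : k < 3 + n
  k<m = <-trans (n<1+n k) k+1<m
  distinct : zero ≢ fromℕ< k<m
  distinct e with trans (cong toℕ e) (toℕ-fromℕ< k<m)
  ... | refl with k+2≡m
  ...   | ()
  only : ∀ w → CycleStep (3 + n) (suc k) (toℕ w) → w ≡ zero ⊎ w ≡ fromℕ< k<m
  only w (next e)        = contradiction (trans e k+2≡m) (<⇒≢ (toℕ<n w))
  only w (prev e)        = inj₂ (toℕ-injective (trans (sym (suc-injective e)) (sym (toℕ-fromℕ< k<m))))
  only w (wrap-next e _) = inj₁ (toℕ-injective e)

module _ {m : ℕ} where

  Between Outside : Fin m → Fin m → Fin m → Set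
  Between lo hi t = toℕ lo < toℕ t × toℕ t < toℕ hi
  Outside lo hi t = toℕ t < toℕ lo ⊎ toℕ hi < toℕ t

  between? : ∀ lo hi t → Dec (Between lo hi t)
  between? lo hi t = (toℕ lo <? toℕ t) ×-dec (toℕ t <? toℕ hi)

  outside? : ∀ lo hi t → Dec (Outside lo hi t)
  outside? lo hi t = (toℕ t <? toℕ lo) ⊎-dec (toℕ hi <? toℕ t)

  between⇒¬outside : ∀ {lo hi t} → toℕ lo ≤ toℕ t → toℕ t ≤ toℕ hi → ¬ Outside lo hi t
  between⇒¬outside lo≤t _    (inj₁ t<lo) = <⇒≱ t<lo lo≤t
  between⇒¬outside _    t≤hi (inj₂ hi<t) = <⇒≱ hi<t t≤hi

  between-arc : ∀ {lo hi t} → Between lo hi t → IsSubpathVertexSet m (Between lo hi)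
  between-arc {lo} {hi} (lo<t , t<hi) = origin , len , 0<len , len≤m , λ u → mk⇔ (into u) (onto u)
    where
    lo+1<hi : suc (toℕ lo) < toℕ hi
    lo+1<hi = ≤-<-trans lo<t t<hi
    origin : Fin m
    origin = fromℕ< (<-trans lo+1<hi (toℕ<n hi))
    toℕ-origin : toℕ origin ≡ suc (toℕ lo)
    toℕ-origin = toℕ-fromℕ< _
    len : ℕ
    len = toℕ hi ∸ suc (toℕ lo)
    0<len : 1 ≤ len
    0<len = m<n⇒0<n∸m lo+1<hi
    len≤m : len ≤ m
    len≤m = ≤-trans (m∸n≤m (toℕ hi) (suc (toℕ lo))) (<⇒≤ (toℕ<n hi))
    end : toℕ origin + len ≡ toℕ hi
    end = trans (cong (_+ len) toℕ-origin) (m+[n∸m]≡n (≤-trans (n≤1+n _) lo+1<hi))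
    into : ∀ u → Between lo hi u → InArc m origin len u
    into u (lo<u , u<hi) =
      inj₁ (subst (_≤ toℕ u) (sym toℕ-origin) lo<u , subst (toℕ u <_) (sym end) u<hi)
    onto : ∀ u → InArc m origin len u → Between lo hi u
    onto u (inj₁ (origin≤u , u<end)) =
      subst (_≤ toℕ u) toℕ-origin origin≤u , subst (toℕ u <_) end u<end
    onto u (inj₂ u+m<end) = ⊥-elim (<-irrefl refl (≤-<-trans (m≤n+m m (toℕ u)) u+m<m))
      where
      u+m<m : toℕ u + m < m
      u+m<m = <-trans (subst (toℕ u + m <_) end u+m<end) (toℕ<n hi)

  wrapping-outside-arc : ∀ {lo hi} → toℕ lo < toℕ hi → suc (toℕ hi) < m
                       → IsSubpathVertexSet m (Outside lo hi)
  wrapping-outside-arc {lo} {hi} lo<hi hi+1<m =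
    origin , len , 0<len , len≤m , λ u → mk⇔ (into u) (onto u)
    where
    origin : Fin m
    origin = fromℕ< hi+1<m
    toℕ-origin : toℕ origin ≡ suc (toℕ hi)
    toℕ-origin = toℕ-fromℕ< hi+1<m
    gap : ℕ
    gap = m ∸ suc (toℕ hi)
    len : ℕ
    len = gap + toℕ lo
    0<len : 1 ≤ len
    0<len = ≤-trans (m<n⇒0<n∸m hi+1<m) (m≤m+n gap (toℕ lo))
    len≤m : len ≤ m
    len≤m = begin
      gap + toℕ lo        ≤⟨ +-monoʳ-≤ gap (≤-trans (<⇒≤ lo<hi) (n≤1+n _)) ⟩
      gap + suc (toℕ hi)  ≡⟨ m∸n+n≡m (<⇒≤ hi+1<m) ⟩
      m                   ∎
      where open ≤-Reasoning
    end : toℕ origin + len ≡ m + toℕ lo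
    end = begin
      toℕ origin + (gap + toℕ lo)    ≡⟨ cong (_+ len) toℕ-origin ⟩
      suc (toℕ hi) + (gap + toℕ lo)  ≡⟨ +-assoc (suc (toℕ hi)) gap (toℕ lo) ⟨
      suc (toℕ hi) + gap + toℕ lo    ≡⟨ cong (_+ toℕ lo) (m+[n∸m]≡n (<⇒≤ hi+1<m)) ⟩
      m + toℕ lo                     ∎
      where open ≡-Reasoning
    into : ∀ u → Outside lo hi u → InArc m origin len u
    into u (inj₁ u<lo) = inj₂ (begin-strict
      toℕ u + m         ≡⟨ +-comm (toℕ u) m ⟩
      m + toℕ u         <⟨ +-monoʳ-< m u<lo ⟩
      m + toℕ lo        ≡⟨ end ⟨
      toℕ origin + len  ∎)
      where open ≤-Reasoning
    into u (inj₂ hi<u) = inj₁ (subst (_≤ toℕ u) (sym toℕ-origin) hi<u , (begin-strict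
      toℕ u             <⟨ <-≤-trans (toℕ<n u) (m≤m+n m (toℕ lo)) ⟩
      m + toℕ lo        ≡⟨ end ⟨
      toℕ origin + len  ∎))
      where open ≤-Reasoning
    onto : ∀ u → InArc m origin len u → Outside lo hi u
    onto u (inj₁ (origin≤u , _)) = inj₂ (subst (_≤ toℕ u) toℕ-origin origin≤u)
    onto u (inj₂ u+m<end) = inj₁ (+-cancelˡ-< m (toℕ u) (toℕ lo) (begin-strict
      m + toℕ u         ≡⟨ +-comm m (toℕ u) ⟩
      toℕ u + m         <⟨ u+m<end ⟩
      toℕ origin + len  ≡⟨ end ⟩
      m + toℕ lo        ∎))
      where open ≤-Reasoning

  initial-outside-arc : ∀ {lo hi} → suc (toℕ hi) ≡ m → 0 < toℕ lo → IsSubpathVertexSet m (Outside lo hi)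
  initial-outside-arc {lo} {hi} hi+1≡m 0<lo =
    origin , toℕ lo , 0<lo , <⇒≤ (toℕ<n lo) , λ u → mk⇔ (into u) (onto u)
    where
    origin : Fin m
    origin = fromℕ< (<-trans 0<lo (toℕ<n lo))
    toℕ-origin : toℕ origin ≡ 0
    toℕ-origin = toℕ-fromℕ< _
    into : ∀ u → Outside lo hi u → InArc m origin (toℕ lo) u
    into u (inj₁ u<lo) =
      inj₁ (subst (_≤ toℕ u) (sym toℕ-origin) z≤n
           , subst (λ k → toℕ u < k + toℕ lo) (sym toℕ-origin) u<lo)
    into u (inj₂ hi<u) = ⊥-elim (<-irrefl hi+1≡m (<-≤-trans (s≤s hi<u) (toℕ<n u)))
    onto : ∀ u → InArc m origin (toℕ lo) u → Outside lo hi u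
    onto u (inj₁ (_ , u<end)) = inj₁ (subst (λ k → toℕ u < k + toℕ lo) toℕ-origin u<end)
    onto u (inj₂ u+m<end) = ⊥-elim (<-irrefl refl (≤-<-trans (m≤n+m m (toℕ u)) u+m<m))
      where
      u+m<m : toℕ u + m < m
      u+m<m = <-trans (subst (λ k → toℕ u + m < k + toℕ lo) toℕ-origin u+m<end) (toℕ<n lo)

  outside-arc : ∀ {lo hi t} → toℕ lo < toℕ hi → Outside lo hi t → IsSubpathVertexSet m (Outside lo hi)
  outside-arc {lo} {hi} {t} lo<hi out-t with suc (toℕ hi) <? m | out-t
  ... | yes hi+1<m | _         = wrapping-outside-arc lo<hi hi+1<m
  ... | no hi+1≮m  | inj₁ t<lo =
    initial-outside-arc (≤-antisym (toℕ<n hi) (≮⇒≥ hi+1≮m)) (≤-<-trans z≤n t<lo)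
  ... | no hi+1≮m  | inj₂ hi<t = contradiction (<-≤-trans (s≤s hi<t) (toℕ<n t)) hi+1≮m

arc-crossing : ∀ {m i l} {lo hi x y : Fin m} → Between lo hi x → Outside lo hi y
             → InArc m i l x → InArc m i l y → InArc m i l lo ⊎ InArc m i l hi
arc-crossing (lo<x , x<hi) (inj₁ y<lo) (inj₁ (i≤x , x<e)) (inj₁ (i≤y , y<e)) =
  inj₁ (inj₁ (≤-trans i≤y (<⇒≤ y<lo) , <-trans lo<x x<e))
arc-crossing (lo<x , x<hi) (inj₂ hi<y) (inj₁ (i≤x , x<e)) (inj₁ (i≤y , y<e)) =
  inj₂ (inj₁ (≤-trans i≤x (<⇒≤ x<hi) , <-trans hi<y y<e))
arc-crossing {m} {hi = hi} {y = y} (lo<x , x<hi) _ (inj₁ (i≤x , x<e)) (inj₂ y+m<e) =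
  inj₂ (inj₁ (≤-trans i≤x (<⇒≤ x<hi) , <-trans (<-≤-trans (toℕ<n hi) (m≤n+m m (toℕ y))) y+m<e))
arc-crossing {m} {x = x} (lo<x , x<hi) (inj₁ y<lo) (inj₂ x+m<e) (inj₁ (i≤y , y<e)) =
  inj₁ (inj₁ (≤-trans i≤y (<⇒≤ y<lo) , <-trans (<-≤-trans lo<x (m≤m+n (toℕ x) m)) x+m<e))
arc-crossing {m} (lo<x , _) (inj₂ _) (inj₂ x+m<e) (inj₁ _) =
  inj₁ (inj₂ (<-trans (+-monoˡ-< m lo<x) x+m<e))
arc-crossing {m} (lo<x , _) (inj₁ _) (inj₂ x+m<e) (inj₂ _) =
  inj₁ (inj₂ (<-trans (+-monoˡ-< m lo<x) x+m<e))
arc-crossing {m} _ (inj₂ hi<y) (inj₂ _) (inj₂ y+m<e) =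
  inj₂ (inj₂ (<-trans (+-monoˡ-< m hi<y) y+m<e))

third-part : (a b : Fin 3) → ∃ λ k → k ≢ a × k ≢ b
third-part zero             zero             = suc zero       , (λ ()) , (λ ())
third-part zero             (suc zero)       = suc (suc zero) , (λ ()) , (λ ())
third-part zero             (suc (suc zero)) = suc zero       , (λ ()) , (λ ())
third-part (suc zero)       zero             = suc (suc zero) , (λ ()) , (λ ())
third-part (suc zero)       (suc zero)       = zero           , (λ ()) , (λ ())
third-part (suc zero)       (suc (suc zero)) = zero           , (λ ()) , (λ ())
third-part (suc (suc zero)) zero             = suc zero       , (λ ()) , (λ ())
third-part (suc (suc zero)) (suc zero)       = zero           , (λ ()) , (λ ())
third-part (suc (suc zero)) (suc (suc zero)) = zero           , (λ ()) , (λ ())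

module HatC (m s : ℕ) (H : Fin s → Fin m → Bool) where

  Ĉ : Adjacency (m + s)
  Ĉ = hatC m s H

  cv : Fin m → Fin (m + s)
  cv i = i ↑ˡ s

  sv : Fin s → Fin (m + s)
  sv w = m ↑ʳ w

  data Vertex : Fin (m + s) → Set where
    cycle : ∀ i → Vertex (cv i)
    extra : ∀ w → Vertex (sv w)

  vertex : ∀ z → Vertex z
  vertex z with splitAt m z | join-splitAt m s z
  ... | inj₁ i | refl = cycle i
  ... | inj₂ w | refl = extra w

  cv-injective : ∀ {i j} → cv i ≡ cv j → i ≡ j
  cv-injective = ↑ˡ-injective s _ _

  cv≢sv : ∀ i w → cv i ≢ sv w
  cv≢sv i w e with trans (sym (splitAt-↑ˡ m i s)) (trans (cong (splitAt m) e) (splitAt-↑ʳ m s w))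
  ... | ()

  adj-cc : ∀ i j → Ĉ (cv i) (cv j) ≡ cycAdj m i j
  adj-cc i j rewrite splitAt-↑ˡ m i s | splitAt-↑ˡ m j s = refl

  adj-cs : ∀ i w → Ĉ (cv i) (sv w) ≡ H w i
  adj-cs i w rewrite splitAt-↑ˡ m i s | splitAt-↑ʳ m s w = refl

  adj-sc : ∀ w i → Ĉ (sv w) (cv i) ≡ H w i
  adj-sc w i rewrite splitAt-↑ˡ m i s | splitAt-↑ʳ m s w = refl

  cycle-edge : ∀ {i j} → CycleStep m (toℕ i) (toℕ j) → T (Ĉ (cv i) (cv j))
  cycle-edge {i} {j} st = subst T (sym (adj-cc i j)) (from (cycAdj⇔cycleStep i j) st)

  cycle-edge⁻ : ∀ {i j} → T (Ĉ (cv i) (cv j)) → CycleStep m (toℕ i) (toℕ j)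
  cycle-edge⁻ {i} {j} e = to (cycAdj⇔cycleStep i j) (subst T (adj-cc i j) e)

  Ĉ-sym : ∀ x y → T (Ĉ x y) → T (Ĉ y x)
  Ĉ-sym x y = sym⊎ (splitAt m x) (splitAt m y)
    where
    sym⊎ : ∀ a b → T (hatAdj⊎ m s H a b) → T (hatAdj⊎ m s H b a)
    sym⊎ (inj₁ i) (inj₁ j) = cycAdj-sym i j
    sym⊎ (inj₁ i) (inj₂ w) e = e
    sym⊎ (inj₂ w) (inj₁ i) e = e
    sym⊎ (inj₂ w) (inj₂ v) ()

  module _ {U : Subset (m + s)} where

    Clear : Fin m → Fin m → Set
    Clear i j = ∀ u → toℕ i ≤ toℕ u → toℕ u ≤ toℕ j → cv u ∉ U

    walk : ∀ i j → toℕ i ≤ toℕ j → Clear i j → Reach Ĉ U (cv i) (cv j)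
    walk i j i≤j = go (toℕ j ∸ toℕ i) i (m∸n+n≡m i≤j)
      where
      go : ∀ d i → d + toℕ i ≡ toℕ j → Clear i j → Reach Ĉ U (cv i) (cv j)
      go zero    i e clear rewrite toℕ-injective e = here (clear j ≤-refl ≤-refl)
      go (suc d) i e clear =
        step (clear i ≤-refl (≤-trans (n≤1+n _) i+1≤j)) (cycle-edge (next (toℕ-fromℕ< i+1<m)))
             (go d (fromℕ< i+1<m) e′ clear′)
        where
        i+1≤j : suc (toℕ i) ≤ toℕ j
        i+1≤j = subst (suc (toℕ i) ≤_) e (s≤s (m≤n+m (toℕ i) d))
        i+1<m : suc (toℕ i) < m
        i+1<m = ≤-<-trans i+1≤j (toℕ<n j)
        e′ : d + toℕ (fromℕ< i+1<m) ≡ toℕ j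
        e′ = trans (cong (d +_) (toℕ-fromℕ< i+1<m)) (trans (+-suc d (toℕ i)) e)
        clear′ : Clear (fromℕ< i+1<m) j
        clear′ u i+1≤u u≤j =
          clear u (≤-trans (n≤1+n _) (subst (_≤ toℕ u) (toℕ-fromℕ< i+1<m) i+1≤u)) u≤j

  degree-two : 3 ≤ m → ∀ t → (∀ w → ¬ T (H w t)) → degree Ĉ (cv t) ≡ 2
  degree-two 3≤m t no-extra with cycle-two-neighbours 3≤m t
  ... | u , v , u≢v , t~u , t~v , only =
    exactly-two⇒∣p∣≡2 (u≢v ∘ cv-injective)
      (∈-tabulate⁺ (cycle-edge t~u)) (∈-tabulate⁺ (cycle-edge t~v))
      (λ z∈ → neighbour _ (∈-tabulate⁻ z∈))
    where
    neighbour : ∀ z → T (Ĉ (cv t) z) → z ≡ cv u ⊎ z ≡ cv v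
    neighbour z adj with vertex z
    ... | cycle j = Data.Sum.map (cong cv) (cong cv) (only j (cycle-edge⁻ adj))
    ... | extra w = ⊥-elim (no-extra w (subst T (adj-cs t w) adj))

-- Cutsets of Ĉ

module Cuts (m s : ℕ) (3≤m : 3 ≤ m) (part : Fin m → Fin 3)
  (arcs : ∀ k → IsSubpathVertexSet m (λ x → part x ≡ k))
  (H : Fin s → Fin m → Bool)
  (H-part : ∀ v k → ∃ λ x → (part x ≡ k × T (H v x)) × (∀ y → part y ≡ k → T (H v y) → y ≡ x))
  where

  open HatC m s H

  0<m : 0 < m
  0<m = ≤-trans (s≤s z≤n) 3≤m

  m-1+1≡m : suc (pred m) ≡ m
  m-1+1≡m = suc-pred m ⦃ >-nonZero 0<m ⦄

  first last : Fin m
  first = fromℕ< 0<m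
  last  = fromℕ< (≤-reflexive m-1+1≡m)

  toℕ-first : toℕ first ≡ 0
  toℕ-first = toℕ-fromℕ< _

  toℕ-last : suc (toℕ last) ≡ m
  toℕ-last = trans (cong suc (toℕ-fromℕ< _)) m-1+1≡m

  first≤ : ∀ (t : Fin m) → toℕ first ≤ toℕ t
  first≤ t = subst (_≤ toℕ t) (sym toℕ-first) z≤n

  ≤last : ∀ (t : Fin m) → toℕ t ≤ toℕ last
  ≤last t = ≤-pred (subst (suc (toℕ t) ≤_) (sym toℕ-last) (toℕ<n t))

  ExtraNeighbour : (Fin m → Set) → Set
  ExtraNeighbour X = ∃ λ w → ∃ λ t → X t × T (H w t)

  extra-neighbour? : ∀ {X} → (∀ t → Dec (X t)) → Dec (ExtraNeighbour X)
  extra-neighbour? X? = any? λ w → any? λ t → X? t ×-dec T? (H w t)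

  wrap-edge : CycleStep m (toℕ last) (toℕ first)
  wrap-edge = wrap-next toℕ-first toℕ-last

  module _ (U : Subset (m + s)) where

    infix 4 _⇝_
    _⇝_ : Fin (m + s) → Fin (m + s) → Set
    _⇝_ = Reach Ĉ U

    ⇝-sym : ∀ {x y} → x ⇝ y → y ⇝ x
    ⇝-sym = reach-sym Ĉ-sym

    around : ∀ i j → (∀ u → toℕ j ≤ toℕ u ⊎ toℕ u ≤ toℕ i → cv u ∉ U) → cv j ⇝ cv i
    around i j clear =
      reach-trans (walk j last (≤last j) (λ u j≤u _ → clear u (inj₁ j≤u)))
        (step (clear last (inj₁ (≤last j))) (cycle-edge wrap-edge)
          (walk first i (first≤ i) (λ u _ u≤i → clear u (inj₂ u≤i))))

    inner-blocker : ∀ i j → toℕ i ≤ toℕ j → ¬ cv i ⇝ cv j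
                  → ∃ λ a → (toℕ i ≤ toℕ a × toℕ a ≤ toℕ j) × cv a ∈ U
    inner-blocker i j i≤j i↯j
      with any? (λ a → ((toℕ i ≤? toℕ a) ×-dec (toℕ a ≤? toℕ j)) ×-dec (cv a ∈? U))
    ... | yes blocker = blocker
    ... | no none = contradiction (walk i j i≤j (λ a i≤a a≤j a∈U → none (a , (i≤a , a≤j) , a∈U))) i↯j

    outer-blocker : ∀ i j → ¬ cv i ⇝ cv j → ∃ λ b → (toℕ j ≤ toℕ b ⊎ toℕ b ≤ toℕ i) × cv b ∈ U
    outer-blocker i j i↯j
      with any? (λ b → ((toℕ j ≤? toℕ b) ⊎-dec (toℕ b ≤? toℕ i)) ×-dec (cv b ∈? U))
    ... | yes blocker = blocker
    ... | no none = contradiction (⇝-sym (around i j (λ b side b∈U → none (b , side , b∈U)))) i↯j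

    record Split : Set where
      field
        lo hi         : Fin m
        lo<hi         : toℕ lo < toℕ hi
        lo∈U          : cv lo ∈ U
        hi∈U          : cv hi ∈ U
        inner outer   : Fin m
        inner-between : Between lo hi inner
        outer-outside : Outside lo hi outer
        separated     : ¬ cv inner ⇝ cv outer

    private
      ∈-∉-apart : ∀ {a b} → cv a ∈ U → cv b ∉ U → toℕ a ≢ toℕ b
      ∈-∉-apart a∈U b∉U e = b∉U (subst (λ x → cv x ∈ U) (toℕ-injective e) a∈U)

    split-ordered : ∀ i j → toℕ i < toℕ j → cv i ∉ U → cv j ∉ U → ¬ cv i ⇝ cv j → Split
    split-ordered i j i<j i∉U j∉U i↯j
      with inner-blocker i j (<⇒≤ i<j) i↯j | outer-blocker i j i↯j
    ... | a , (i≤a , a≤j) , a∈U | b , inj₁ j≤b , b∈U = record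
      { lo = a ; hi = b ; lo<hi = <-trans a<j j<b ; lo∈U = a∈U ; hi∈U = b∈U
      ; inner = j ; outer = i ; inner-between = a<j , j<b ; outer-outside = inj₁ i<a
      ; separated = i↯j ∘ ⇝-sym }
      where
      i<a : toℕ i < toℕ a
      i<a = ≤∧≢⇒< i≤a (∈-∉-apart a∈U i∉U ∘ sym)
      a<j : toℕ a < toℕ j
      a<j = ≤∧≢⇒< a≤j (∈-∉-apart a∈U j∉U)
      j<b : toℕ j < toℕ b
      j<b = ≤∧≢⇒< j≤b (∈-∉-apart b∈U j∉U ∘ sym)
    ... | a , (i≤a , a≤j) , a∈U | b , inj₂ b≤i , b∈U = record
      { lo = b ; hi = a ; lo<hi = <-trans b<i i<a ; lo∈U = b∈U ; hi∈U = a∈U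
      ; inner = i ; outer = j ; inner-between = b<i , i<a ; outer-outside = inj₂ a<j
      ; separated = i↯j }
      where
      b<i : toℕ b < toℕ i
      b<i = ≤∧≢⇒< b≤i (∈-∉-apart b∈U i∉U)
      i<a : toℕ i < toℕ a
      i<a = ≤∧≢⇒< i≤a (∈-∉-apart a∈U i∉U ∘ sym)
      a<j : toℕ a < toℕ j
      a<j = ≤∧≢⇒< a≤j (∈-∉-apart a∈U j∉U)

    SplitsOffDegreeTwoArc : Set
    SplitsOffDegreeTwoArc =
      ∃ λ x → ∃ λ y → x ∉ U × y ∉ U × ¬ x ⇝ y × (∀ z → z ∉ U → z ⇝ x ⊎ z ⇝ y)
        × IsSubpathVertexSet m (λ i → cv i ⇝ x)
        × (∀ z → z ⇝ x → IsCycleVertex m s z × degree Ĉ z ≡ 2)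

    record Piece (X : Fin m → Set) : Set where
      field
        rep       : Fin m
        rep∈      : X rep
        connected : ∀ t → X t → cv t ⇝ cv rep
        closed    : ∀ t t′ → X t′ → CycleStep m (toℕ t) (toℕ t′) → cv t ∉ U → X t
        arc       : IsSubpathVertexSet m X

    extra-free-piece : ∀ {X} (piece : Piece X) → ¬ ExtraNeighbour X
                     → ∀ y → y ∉ U → ¬ cv (Piece.rep piece) ⇝ y
                     → (∀ z → z ∉ U → z ⇝ cv (Piece.rep piece) ⊎ z ⇝ y) → SplitsOffDegreeTwoArc
    extra-free-piece {X} piece no-extra y y∉U r↯y every =
      cv rep , y , reach-source (connected rep rep∈) , y∉U , r↯y , every
        , component-arc , on-component
      where
      open Piece piece

      OnX : Fin (m + s) → Set
      OnX z = ∃ λ t → z ≡ cv t × X t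

      OnX-closed : ∀ {z z′} → z ∉ U → T (Ĉ z z′) → OnX z′ → OnX z
      OnX-closed {z} z∉U adj (t′ , refl , Xt′) with vertex z
      ... | cycle t = t , refl , closed t t′ Xt′ (cycle-edge⁻ adj) z∉U
      ... | extra w = ⊥-elim (no-extra (w , t′ , Xt′ , subst T (adj-sc w t′) adj))

      component⊆X : ∀ {z} → z ⇝ cv rep → OnX z
      component⊆X z⇝r = reach-closed OnX OnX-closed z⇝r (rep , refl , rep∈)

      component⇔X : ∀ t → cv t ⇝ cv rep ⇔ X t
      component⇔X t = mk⇔
        (λ t⇝r → let _ , e , Xt′ = component⊆X t⇝r in subst X (sym (cv-injective e)) Xt′)
        (connected t)

      component-arc : IsSubpathVertexSet m (λ i → cv i ⇝ cv rep)
      component-arc =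
        let i , l , 1≤l , l≤m , X⇔arc = arc in i , l , 1≤l , l≤m , λ t → X⇔arc t ⇔-∘ component⇔X t

      on-component : ∀ z → z ⇝ cv rep → IsCycleVertex m s z × degree Ĉ z ≡ 2
      on-component z z⇝r with component⊆X z⇝r
      ... | t , refl , Xt = (t , refl) , degree-two 3≤m t (λ w h → no-extra (w , t , Xt , h))

    module _ (∣U∣≤2 : ∣ U ∣ ≤ 2) where

      extra-exit : ∀ w → ∃ λ t → T (H w t) × cv t ∉ U
      extra-exit w with H-part w zero | H-part w (suc zero) | H-part w (suc (suc zero))
      ... | x₀ , (p₀ , h₀) , _ | x₁ , (p₁ , h₁) , _ | x₂ , (p₂ , h₂) , _
          with cv x₀ ∈? U | cv x₁ ∈? U | cv x₂ ∈? U
      ... | no x₀∉U  | _        | _        = x₀ , h₀ , x₀∉U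
      ... | yes _    | no x₁∉U  | _        = x₁ , h₁ , x₁∉U
      ... | yes _    | yes _    | no x₂∉U  = x₂ , h₂ , x₂∉U
      ... | yes x₀∈U | yes x₁∈U | yes x₂∈U =
        ⊥-elim ([ apart p₀ p₁ (λ ()) , [ apart p₀ p₂ (λ ()) , apart p₁ p₂ (λ ()) ]′ ]′
                  (∣p∣≤2⇒pigeonhole ∣U∣≤2 x₀∈U x₁∈U x₂∈U))
        where
        apart : ∀ {x y k l} → part x ≡ k → part y ≡ l → k ≢ l → cv x ≢ cv y
        apart px py k≢l e = k≢l (trans (sym px) (trans (cong part (cv-injective e)) py))

      to-cycle : ∀ z → z ∉ U → ∃ λ t → cv t ∉ U × z ⇝ cv t
      to-cycle z z∉U with vertex z
      ... | cycle i = i , z∉U , here z∉U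
      ... | extra w with extra-exit w
      ...   | t , h , t∉U = t , t∉U , reach-edge z∉U t∉U (subst T (sym (adj-sc w t)) h)

      split : Cutset Ĉ U → Split
      split (x , y , x∉U , y∉U , x↯y) with to-cycle x x∉U | to-cycle y y∉U
      ... | i , i∉U , x⇝i | j , j∉U , y⇝j with <-cmp (toℕ i) (toℕ j)
      ... | tri< i<j _ _ = split-ordered i j i<j i∉U j∉U λ i⇝j → x↯y (chain i⇝j)
        where
        chain : cv i ⇝ cv j → x ⇝ y
        chain i⇝j = reach-trans x⇝i (reach-trans i⇝j (⇝-sym y⇝j))
      ... | tri> _ _ j<i = split-ordered j i j<i j∉U i∉U λ j⇝i → x↯y (chain j⇝i)
        where
        chain : cv j ⇝ cv i → x ⇝ y
        chain j⇝i = reach-trans x⇝i (reach-trans (⇝-sym j⇝i) (⇝-sym y⇝j))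
      ... | tri≈ _ i≡j _ rewrite toℕ-injective i≡j = contradiction (reach-trans x⇝i (⇝-sym y⇝j)) x↯y

      module Sides (sp : Split) where
        open Split sp

        Inner Outer : Fin m → Set
        Inner = Between lo hi
        Outer = Outside lo hi

        U≡lo,hi : ∀ {z} → z ∈ U → z ≡ cv lo ⊎ z ≡ cv hi
        U≡lo,hi z∈U with ∣p∣≤2⇒pigeonhole ∣U∣≤2 z∈U lo∈U hi∈U
        ... | inj₁ z≡lo         = inj₁ z≡lo
        ... | inj₂ (inj₁ z≡hi)  = inj₂ z≡hi
        ... | inj₂ (inj₂ lo≡hi) = contradiction (cong toℕ (cv-injective lo≡hi)) (<⇒≢ lo<hi)

        U⊆cycle : ∀ z → z ∈ U → IsCycleVertex m s z
        U⊆cycle z z∈U = [ (λ e → lo , e) , (λ e → hi , e) ]′ (U≡lo,hi z∈U)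

        sv∉U : ∀ w → sv w ∉ U
        sv∉U w w∈U = [ cv≢sv lo w ∘ sym , cv≢sv hi w ∘ sym ]′ (U≡lo,hi w∈U)

        ≢lo,hi⇒∉U : ∀ t → toℕ t ≢ toℕ lo → toℕ t ≢ toℕ hi → cv t ∉ U
        ≢lo,hi⇒∉U t ≢lo ≢hi t∈U =
          [ ≢lo ∘ cong toℕ ∘ cv-injective , ≢hi ∘ cong toℕ ∘ cv-injective ]′ (U≡lo,hi t∈U)

        ∉U⇒≢lo : ∀ {t} → cv t ∉ U → toℕ t ≢ toℕ lo
        ∉U⇒≢lo t∉U e = t∉U (subst (λ x → cv x ∈ U) (toℕ-injective (sym e)) lo∈U)

        ∉U⇒≢hi : ∀ {t} → cv t ∉ U → toℕ t ≢ toℕ hi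
        ∉U⇒≢hi t∉U e = t∉U (subst (λ x → cv x ∈ U) (toℕ-injective (sym e)) hi∈U)

        inner∉U : ∀ t → Inner t → cv t ∉ U
        inner∉U t (lo<t , t<hi) = ≢lo,hi⇒∉U t (>⇒≢ lo<t) (<⇒≢ t<hi)

        outer∉U : ∀ t → Outer t → cv t ∉ U
        outer∉U t (inj₁ t<lo) = ≢lo,hi⇒∉U t (<⇒≢ t<lo) (<⇒≢ (<-trans t<lo lo<hi))
        outer∉U t (inj₂ hi<t) = ≢lo,hi⇒∉U t (>⇒≢ (<-trans lo<hi hi<t)) (>⇒≢ hi<t)

        classify : ∀ t → cv t ∉ U → Inner t ⊎ Outer t
        classify t t∉U with <-cmp (toℕ t) (toℕ lo) | <-cmp (toℕ t) (toℕ hi)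
        ... | tri< t<lo _ _ | _             = inj₂ (inj₁ t<lo)
        ... | tri≈ _ t≡lo _ | _             = contradiction t≡lo (∉U⇒≢lo t∉U)
        ... | tri> _ _ lo<t | tri< t<hi _ _ = inj₁ (lo<t , t<hi)
        ... | tri> _ _ _    | tri≈ _ t≡hi _ = contradiction t≡hi (∉U⇒≢hi t∉U)
        ... | tri> _ _ _    | tri> _ _ hi<t = inj₂ (inj₂ hi<t)

        inner-walk : ∀ t u → Inner t → Inner u → toℕ t ≤ toℕ u → cv t ⇝ cv u
        inner-walk t u (lo<t , _) (_ , u<hi) t≤u =
          walk t u t≤u (λ v t≤v v≤u → inner∉U v (<-≤-trans lo<t t≤v , ≤-<-trans v≤u u<hi))

        inner-connected : ∀ t u → Inner t → Inner u → cv t ⇝ cv u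
        inner-connected t u in-t in-u with ≤-total (toℕ t) (toℕ u)
        ... | inj₁ t≤u = inner-walk t u in-t in-u t≤u
        ... | inj₂ u≤t = ⇝-sym (inner-walk u t in-u in-t u≤t)

        below⇝first : ∀ t → toℕ t < toℕ lo → cv t ⇝ cv first
        below⇝first t t<lo =
          ⇝-sym (walk first t (first≤ t) (λ v _ v≤t → outer∉U v (inj₁ (≤-<-trans v≤t t<lo))))

        above⇝last : ∀ t → toℕ hi < toℕ t → cv t ⇝ cv last
        above⇝last t hi<t = walk t last (≤last t) (λ v t≤v _ → outer∉U v (inj₂ (<-≤-trans hi<t t≤v)))

        below⇝above : ∀ t u → toℕ t < toℕ lo → toℕ hi < toℕ u → cv t ⇝ cv u
        below⇝above t u t<lo hi<u =
          reach-trans (below⇝first t t<lo)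
            (step first∉U (cycle-edge (cycleStep-sym wrap-edge)) (⇝-sym (above⇝last u hi<u)))
          where
          first∉U : cv first ∉ U
          first∉U = outer∉U first (inj₁ (≤-<-trans (first≤ t) t<lo))

        outer-connected : ∀ t u → Outer t → Outer u → cv t ⇝ cv u
        outer-connected t u (inj₁ t<lo) (inj₁ u<lo) =
          reach-trans (below⇝first t t<lo) (⇝-sym (below⇝first u u<lo))
        outer-connected t u (inj₂ hi<t) (inj₂ hi<u) =
          reach-trans (above⇝last t hi<t) (⇝-sym (above⇝last u hi<u))
        outer-connected t u (inj₁ t<lo) (inj₂ hi<u) = below⇝above t u t<lo hi<u
        outer-connected t u (inj₂ hi<t) (inj₁ u<lo) = ⇝-sym (below⇝above u t u<lo hi<t)

        inner↯outer : ∀ t u → Inner t → Outer u → ¬ cv t ⇝ cv u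
        inner↯outer t u in-t out-u t⇝u = separated
          (reach-trans (inner-connected inner t inner-between in-t)
            (reach-trans t⇝u (outer-connected u outer out-u outer-outside)))

        inner-or-outer : ∀ z → z ∉ U → z ⇝ cv inner ⊎ z ⇝ cv outer
        inner-or-outer z z∉U with to-cycle z z∉U
        ... | t , t∉U , z⇝t with classify t t∉U
        ...   | inj₁ in-t  = inj₁ (reach-trans z⇝t (inner-connected t inner in-t inner-between))
        ...   | inj₂ out-t = inj₂ (reach-trans z⇝t (outer-connected t outer out-t outer-outside))

        inner-closed : ∀ t t′ → Inner t′ → CycleStep m (toℕ t) (toℕ t′) → cv t ∉ U → Inner t
        inner-closed t t′ (lo<t′ , t′<hi) st t∉U =
          let lo≤t , t≤hi = cycleStep-inside lo<t′ t′<hi (toℕ<n hi) (cycleStep-sym st)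
          in  ≤∧≢⇒< lo≤t (∉U⇒≢lo t∉U ∘ sym) , ≤∧≢⇒< t≤hi (∉U⇒≢hi t∉U)

        outer-closed : ∀ t t′ → Outer t′ → CycleStep m (toℕ t) (toℕ t′) → cv t ∉ U → Outer t
        outer-closed t t′ out-t′ st t∉U with classify t t∉U
        ... | inj₂ out-t          = out-t
        ... | inj₁ (lo<t , t<hi) =
          let lo≤t′ , t′≤hi = cycleStep-inside lo<t t<hi (toℕ<n hi) st
          in  contradiction out-t′ (between⇒¬outside lo≤t′ t′≤hi)

        inner-piece : Piece Inner
        inner-piece = record
          { rep = inner ; rep∈ = inner-between
          ; connected = λ t in-t → inner-connected t inner in-t inner-between
          ; closed = inner-closed ; arc = between-arc inner-between }

        outer-piece : Piece Outer
        outer-piece = record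
          { rep = outer ; rep∈ = outer-outside
          ; connected = λ t out-t → outer-connected t outer out-t outer-outside
          ; closed = outer-closed ; arc = outside-arc lo<hi outer-outside }

        via-extra : ∀ w {t x} → cv t ∉ U → T (H w t) → cv x ∉ U → T (H w x) → cv t ⇝ cv x
        via-extra w {t} {x} t∉U ht x∉U hx =
          step t∉U (subst T (sym (adj-cs t w)) ht)
            (reach-edge (sv∉U w) x∉U (subst T (sym (adj-sc w x)) hx))

        ¬extra-on-both-sides : ExtraNeighbour Inner → ExtraNeighbour Outer → ⊥
        ¬extra-on-both-sides (w₁ , t₁ , in-t₁ , h₁) (w₂ , t₂ , out-t₂ , h₂)
          with third-part (part lo) (part hi)
        ... | k , k≢lo , k≢hi with H-part w₁ k | H-part w₂ k
        ...   | x₁ , (k-x₁ , hx₁) , _ | x₂ , (k-x₂ , hx₂) , _ =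
          crossing (classify x₁ (∉U x₁ k-x₁)) (classify x₂ (∉U x₂ k-x₂))
          where
          ∉U : ∀ x → part x ≡ k → cv x ∉ U
          ∉U x kx = ≢lo,hi⇒∉U x (λ e → k≢lo (trans (sym kx) (cong part (toℕ-injective e))))
                                (λ e → k≢hi (trans (sym kx) (cong part (toℕ-injective e))))

          t₁⇝x₁ : cv t₁ ⇝ cv x₁
          t₁⇝x₁ = via-extra w₁ (inner∉U t₁ in-t₁) h₁ (∉U x₁ k-x₁) hx₁

          x₂⇝t₂ : cv x₂ ⇝ cv t₂
          x₂⇝t₂ = via-extra w₂ (∉U x₂ k-x₂) hx₂ (outer∉U t₂ out-t₂) h₂

          crossing : Inner x₁ ⊎ Outer x₁ → Inner x₂ ⊎ Outer x₂ → ⊥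
          crossing (inj₂ out-x₁) _ = inner↯outer t₁ x₁ in-t₁ out-x₁ t₁⇝x₁
          crossing _ (inj₁ in-x₂) = inner↯outer x₂ t₂ in-x₂ out-t₂ x₂⇝t₂
          crossing (inj₁ in-x₁) (inj₂ out-x₂) with arcs k
          ... | i , l , _ , _ , k⇔arc
            with arc-crossing in-x₁ out-x₂ (to (k⇔arc x₁) k-x₁) (to (k⇔arc x₂) k-x₂)
          ...   | inj₁ lo∈arc = k≢lo (sym (from (k⇔arc lo) lo∈arc))
          ...   | inj₂ hi∈arc = k≢hi (sym (from (k⇔arc hi) hi∈arc))

        result : SplitsOffDegreeTwoArc
        result with extra-neighbour? (between? lo hi) | extra-neighbour? (outside? lo hi)
        ... | no none | _ =
          extra-free-piece inner-piece none (cv outer) (outer∉U outer outer-outside)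
            separated inner-or-outer
        ... | yes _ | no none =
          extra-free-piece outer-piece none (cv inner) (inner∉U inner inner-between)
            (separated ∘ ⇝-sym) (λ z z∉U → Data.Sum.swap (inner-or-outer z z∉U))
        ... | yes inner-extra | yes outer-extra =
          ⊥-elim (¬extra-on-both-sides inner-extra outer-extra)

lemma4p4 : (m s : ℕ) → 3 ≤ m
    → (part : Fin m → Fin 3)
    → (∀ k → ∃ λ x → part x ≡ k)
    → (∀ k → IsSubpathVertexSet m (λ x → part x ≡ k))
    → (H : Fin s → Fin m → Bool)
    → (∀ v k → ∃ λ x → (part x ≡ k × T (H v x))
         × (∀ y → part y ≡ k → T (H v y) → y ≡ x))
    → (∀ x v w → T (H v x) → T (H w x) → v ≡ w)
    → KConnected 2 (hatC m s H)
      × (∀ (U : Subset (m + s)) → ∣ U ∣ ≡ 2 → Cutset (hatC m s H) U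
         → (∀ z → z ∈ U → IsCycleVertex m s z)
           × (∃ λ x → ∃ λ y → x ∉ U × y ∉ U
                × ¬ Reach (hatC m s H) U x y
                × (∀ z → z ∉ U → Reach (hatC m s H) U z x ⊎ Reach (hatC m s H) U z y)
                × IsSubpathVertexSet m (λ i → Reach (hatC m s H) U (i ↑ˡ s) x)
                × (∀ z → Reach (hatC m s H) U z x
                     → IsCycleVertex m s z × degree (hatC m s H) z ≡ 2)))
lemma4p4 m s 3≤m part _ arcs H H-part _ = two-connected , two-cuts
  where
  open HatC m s H
  open Cuts m s 3≤m part arcs H H-part

  no-small-cut : ∀ U → ∣ U ∣ < 2 → ¬ Cutset Ĉ U
  no-small-cut U (s≤s ∣U∣≤1) cut =
    <⇒≢ lo<hi (cong toℕ (cv-injective (∣p∣≤1⇒x∈p⇒y∈p⇒x≡y ∣U∣≤1 lo∈U hi∈U)))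
    where open Split (split U (m≤n⇒m≤1+n ∣U∣≤1) cut)

  two-connected : KConnected 2 Ĉ
  two-connected = ≤-trans 3≤m (m≤m+n m s) , no-small-cut

  two-cuts : ∀ U → ∣ U ∣ ≡ 2 → Cutset Ĉ U
           → (∀ z → z ∈ U → IsCycleVertex m s z) × SplitsOffDegreeTwoArc U
  two-cuts U ∣U∣≡2 cut = U⊆cycle , result
    where open Sides U (≤-reflexive ∣U∣≡2) (split U (≤-reflexive ∣U∣≡2) cut)
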